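{- Let $G$ be a finite almost simple group and $S=\mathrm{soc}(G)$. Then $C_{\mathrm{Sym}(G)}(S^*)=1$.
   Context: $G$ is almost simple if $\mathrm{soc}(G)$ is a nonabelian simple group. $S_{left},S_{right}\le\mathrm{Sym}(G)$ are the groups of permutations $g\mapsto xg$ and $g\mapsto gx$ ($x\in S$), and $S^*=S_{left}S_{right}$. -}

module Defs where

open import Data.Nat using (ℕ)
open import Data.Fin using (Fin)
open import Data.Product using (Σ; _×_; ∃; _,_)
open import Data.Sum using (_⊎_)
open import Data.Unit using (⊤)
open import Relation.Nullary using (¬_)
open import Relation.Binary.PropositionalEquality using (_≡_)
open import Algebra.Structures using (IsGroup)
open import Function.Bundles using (_↔_; Inverse)

record FinGroup : Set₁ where
  infixl 7 _∙_
  field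
    Carrier : Set
    _∙_     : Carrier → Carrier → Carrier
    ε       : Carrier
    _⁻¹     : Carrier → Carrier
    isGroup : IsGroup _≡_ _∙_ ε _⁻¹
    order   : ℕ
    enum    : Carrier ↔ Fin order

module _ (G : FinGroup) where
  open FinGroup G

  Subset : Set₁
  Subset = Carrier → Set

  _⊆_ : Subset → Subset → Set
  A ⊆ B = ∀ x → A x → B x

  IsSubgroup : Subset → Set
  IsSubgroup H = H ε × (∀ x y → H x → H y → H (x ∙ y)) × (∀ x → H x → H (x ⁻¹))

  IsNormalIn : Subset → Subset → Set
  IsNormalIn H K = IsSubgroup H × H ⊆ K × (∀ k h → K k → H h → H ((k ∙ h) ∙ (k ⁻¹)))

  Whole : Subset
  Whole _ = ⊤

  IsNormal : Subset → Set
  IsNormal H = IsNormalIn H Whole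

  IsTrivial : Subset → Set
  IsTrivial H = ∀ x → H x → x ≡ ε

  IsMinimalNormal : Subset → Set₁
  IsMinimalNormal N = IsNormal N × ¬ IsTrivial N ×
    (∀ M → IsNormal M → M ⊆ N → IsTrivial M ⊎ N ⊆ M)

  -- S is the socle: the subgroup generated by all minimal normal subgroups,
  -- i.e. the least subgroup containing every minimal normal subgroup.
  IsSocle : Subset → Set₁
  IsSocle S = IsSubgroup S × (∀ N → IsMinimalNormal N → N ⊆ S) ×
    (∀ H → IsSubgroup H → (∀ N → IsMinimalNormal N → N ⊆ H) → S ⊆ H)

  IsNonabelianSimple : Subset → Set₁
  IsNonabelianSimple S = IsSubgroup S × ¬ IsTrivial S ×
    ¬ (∀ x y → S x → S y → x ∙ y ≡ y ∙ x) ×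
    (∀ H → IsNormalIn H S → IsTrivial H ⊎ S ⊆ H)

  IsAlmostSimple : Set₁
  IsAlmostSimple = Σ Subset λ S → IsSocle S × IsNonabelianSimple S

  -- σ ∈ Sym(G) centralises S* = S_left S_right, whose elements are the maps
  -- g ↦ x g y with x, y ∈ S
  Centralises* : Subset → (Carrier ↔ Carrier) → Set
  Centralises* S σ = ∀ x y g → S x → S y →
    Inverse.to σ ((x ∙ g) ∙ y) ≡ (x ∙ Inverse.to σ g) ∙ y

-- Let σ centralise S*.  Comparing σ(g t) = σ(g) t with
-- σ((g t g⁻¹) g) = (g t g⁻¹) σ(g) shows that the displacement g⁻¹ σ(g)
-- centralises S (S is invariant under conjugation).  So it suffices to show
-- that C_G(S) = 1.  Now C_G(S) is normal in G and C_G(S) ∩ S = Z(S) = 1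
-- because S is nonabelian simple.  A nontrivial normal subgroup of a finite
-- group contains a minimal normal subgroup, which lies in the socle S and
-- hence in C_G(S) ∩ S = 1: a contradiction.
--
-- The only classical step is the descent to a minimal normal subgroup.  It
-- is made constructive by the observation that a minimal normal subgroup N
-- with an explicit element x ≠ 1 decides every proposition P (the normal
-- subgroup 1 ∪ {n ∈ N | P} is either 1 or N).  Since we argue towards a
-- contradiction, we may assume such an N, and so excluded middle.
module Submission where

open import Defs
open import Level using (0ℓ)
open import Relation.Binary.PropositionalEquality
open import Function.Bundles using (_↔_; Inverse)
open import Function.Properties.Inverse using (↔⇒↣)
open import Data.Product using (Σ; _×_; _,_; proj₁; proj₂)
open import Data.Sum using (_⊎_; inj₁; inj₂)
open import Data.Empty using (⊥; ⊥-elim)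
open import Data.Unit using (tt)
open import Data.Bool using (Bool; T)
open import Data.Nat using (zero; suc; _≤_)
open import Data.Nat.Properties using (≤-trans; ≤-refl; ≤-pred)
open import Data.List using (List; []; length; filter; map; allFin)
open import Data.List.Membership.Propositional using (_∈_)
open import Data.List.Membership.Propositional.Properties using (∈-filter⁺; ∈-map⁺; ∈-allFin; ∉[])
open import Data.List.Properties using (filter-notAll)
import Data.List.Relation.Unary.Any as Any
open import Relation.Nullary using (¬_; Dec; yes; no; ¬?; isYes)
open import Relation.Nullary.Decidable using (toWitness; fromWitness)
open import Axiom.ExcludedMiddle using (ExcludedMiddle)
open import Data.Fin.Properties using (inj⇒≟)
open import Algebra.Bundles using (Group)
open import Algebra.Structures using (IsGroup)
import Algebra.Properties.Group as GroupProperties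
import Algebra.Properties.Monoid as MonoidProperties

module _ (G : FinGroup) where
  open FinGroup G
  open IsGroup isGroup using (assoc; identityˡ; identityʳ; inverseˡ; inverseʳ)

  group : Group _ _
  group = record { isGroup = isGroup }

  open GroupProperties group using (⁻¹-involutive; ε⁻¹≈ε; inverseʳ-unique)
  open MonoidProperties (Group.monoid group) using (cancelˡ; cancelʳ; cancelᶜ)
  open ≡-Reasoning

  conj : Carrier → Carrier → Carrier
  conj k x = (k ∙ x) ∙ k ⁻¹

  conj-ε : ∀ k → conj k ε ≡ ε
  conj-ε k = trans (cong (_∙ k ⁻¹) (identityʳ k)) (inverseʳ k)

  conj-∙ : ∀ k x y → conj k (x ∙ y) ≡ conj k x ∙ conj k y
  conj-∙ k x y = sym (begin
    conj k x ∙ ((k ∙ y) ∙ k ⁻¹) ≡⟨ cong (conj k x ∙_) (assoc k y (k ⁻¹)) ⟩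
    ((k ∙ x) ∙ k ⁻¹) ∙ (k ∙ (y ∙ k ⁻¹)) ≡⟨ cancelᶜ (inverseˡ k) (k ∙ x) (y ∙ k ⁻¹) ⟩
    (k ∙ x) ∙ (y ∙ k ⁻¹) ≡⟨ sym (assoc (k ∙ x) y (k ⁻¹)) ⟩
    ((k ∙ x) ∙ y) ∙ k ⁻¹ ≡⟨ cong (_∙ k ⁻¹) (assoc k x y) ⟩
    conj k (x ∙ y) ∎)

  conj-⁻¹ : ∀ k x → conj k (x ⁻¹) ≡ conj k x ⁻¹
  conj-⁻¹ k x = inverseʳ-unique (conj k x) (conj k (x ⁻¹)) (begin
    conj k x ∙ conj k (x ⁻¹) ≡⟨ sym (conj-∙ k x (x ⁻¹)) ⟩
    conj k (x ∙ x ⁻¹) ≡⟨ cong (conj k) (inverseʳ x) ⟩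
    conj k ε ≡⟨ conj-ε k ⟩
    ε ∎)

  conj-conj⁻¹ : ∀ k s → conj k (conj (k ⁻¹) s) ≡ s
  conj-conj⁻¹ k s = begin
    (k ∙ ((k ⁻¹ ∙ s) ∙ k ⁻¹ ⁻¹)) ∙ k ⁻¹ ≡⟨ cong (λ z → (k ∙ ((k ⁻¹ ∙ s) ∙ z)) ∙ k ⁻¹) (⁻¹-involutive k) ⟩
    (k ∙ ((k ⁻¹ ∙ s) ∙ k)) ∙ k ⁻¹ ≡⟨ cong (_∙ k ⁻¹) (sym (assoc k (k ⁻¹ ∙ s) k)) ⟩
    ((k ∙ (k ⁻¹ ∙ s)) ∙ k) ∙ k ⁻¹ ≡⟨ cong (λ z → (z ∙ k) ∙ k ⁻¹) (cancelˡ (inverseʳ k) s) ⟩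
    (s ∙ k) ∙ k ⁻¹ ≡⟨ cancelʳ (inverseʳ k) s ⟩
    s ∎

  Commute : Carrier → Carrier → Set
  Commute y s = y ∙ s ≡ s ∙ y

  commute-∙ : ∀ y z s → Commute y s → Commute z s → Commute (y ∙ z) s
  commute-∙ y z s ys zs = begin
    (y ∙ z) ∙ s ≡⟨ assoc y z s ⟩
    y ∙ (z ∙ s) ≡⟨ cong (y ∙_) zs ⟩
    y ∙ (s ∙ z) ≡⟨ sym (assoc y s z) ⟩
    (y ∙ s) ∙ z ≡⟨ cong (_∙ z) ys ⟩
    (s ∙ y) ∙ z ≡⟨ assoc s y z ⟩
    s ∙ (y ∙ z) ∎

  commute-⁻¹ : ∀ y s → Commute y s → Commute (y ⁻¹) s
  commute-⁻¹ y s ys = begin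
    y ⁻¹ ∙ s ≡⟨ cong (y ⁻¹ ∙_) (sym (cancelʳ (inverseʳ y) s)) ⟩
    y ⁻¹ ∙ ((s ∙ y) ∙ y ⁻¹) ≡⟨ cong (λ z → y ⁻¹ ∙ (z ∙ y ⁻¹)) (sym ys) ⟩
    y ⁻¹ ∙ ((y ∙ s) ∙ y ⁻¹) ≡⟨ cong (y ⁻¹ ∙_) (assoc y s (y ⁻¹)) ⟩
    y ⁻¹ ∙ (y ∙ (s ∙ y ⁻¹)) ≡⟨ cancelˡ (inverseˡ y) (s ∙ y ⁻¹) ⟩
    s ∙ y ⁻¹ ∎

  commute-conj : ∀ k y s → Commute y s → Commute (conj k y) (conj k s)
  commute-conj k y s ys = trans (sym (conj-∙ k y s)) (trans (cong (conj k) ys) (conj-∙ k s y))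

  _≟_ : (x y : Carrier) → Dec (x ≡ y)
  _≟_ = inj⇒≟ (↔⇒↣ enum)

  elements : List Carrier
  elements = map (Inverse.from enum) (allFin order)

  ∈-elements : ∀ x → x ∈ elements
  ∈-elements x = subst (_∈ elements) (Inverse.strictlyInverseʳ enum x)
    (∈-map⁺ (Inverse.from enum) (∈-allFin (Inverse.to enum x)))

  trivialSubgroup : IsSubgroup G (_≡ ε)
  trivialSubgroup = refl
    , (λ x y x≡ε y≡ε → trans (cong₂ _∙_ x≡ε y≡ε) (identityˡ ε))
    , (λ x x≡ε → trans (cong _⁻¹ x≡ε) ε⁻¹≈ε)

  normal-resp : (A B : Subset G) → (∀ y → A y → B y) → (∀ y → B y → A y) →
    IsNormal G A → IsNormal G B
  normal-resp A B A⇒B B⇒A ((Aε , A∙ , A⁻) , _ , Aconj) =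
    ( A⇒B ε Aε
    , (λ x y Bx By → A⇒B _ (A∙ x y (B⇒A x Bx) (B⇒A y By)))
    , (λ x Bx → A⇒B _ (A⁻ x (B⇒A x Bx))))
    , (λ _ _ → tt)
    , (λ k h _ Bh → A⇒B _ (Aconj k h tt (B⇒A h Bh)))

  ConjugationClosed : Subset G → Set
  ConjugationClosed T = ∀ k s → T s → T (conj k s)

  -- The socle is invariant under conjugation: its preimage under conj k is
  -- a subgroup containing every minimal normal subgroup.
  socle-conjugationClosed : (S : Subset G) → IsSocle G S → ConjugationClosed S
  socle-conjugationClosed S ((Sε , S∙ , S⁻) , minimal⊆S , least) k s Ss =
    least (λ x → S (conj k x)) preimageSubgroup minimal⊆preimage s Ss
    where
    preimageSubgroup : IsSubgroup G (λ x → S (conj k x))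
    preimageSubgroup = subst S (sym (conj-ε k)) Sε
      , (λ x y Sx Sy → subst S (sym (conj-∙ k x y)) (S∙ _ _ Sx Sy))
      , (λ x Sx → subst S (sym (conj-⁻¹ k x)) (S⁻ _ Sx))
    minimal⊆preimage : ∀ N → IsMinimalNormal G N → _⊆_ G N (λ x → S (conj k x))
    minimal⊆preimage N N-minimal@((_ , _ , Nconj) , _) x Nx = minimal⊆S N N-minimal (conj k x) (Nconj k x tt Nx)

  Centraliser : Subset G → Subset G
  Centraliser T y = ∀ s → T s → Commute y s

  centraliser-subgroup : (T : Subset G) → IsSubgroup G (Centraliser T)
  centraliser-subgroup T = (λ s _ → trans (identityˡ s) (sym (identityʳ s)))
    , (λ y z Cy Cz s Ts → commute-∙ y z s (Cy s Ts) (Cz s Ts))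
    , (λ y Cy s Ts → commute-⁻¹ y s (Cy s Ts))

  centraliser-conjugationClosed : (T : Subset G) → ConjugationClosed T →
    ConjugationClosed (Centraliser T)
  centraliser-conjugationClosed T Tconj k y Cy s Ts =
    subst (Commute (conj k y)) (conj-conj⁻¹ k s)
      (commute-conj k y (conj (k ⁻¹) s) (Cy _ (Tconj (k ⁻¹) s Ts)))

  centraliser-normal : (T : Subset G) → ConjugationClosed T → IsNormal G (Centraliser T)
  centraliser-normal T Tconj = centraliser-subgroup T , (λ _ _ → tt) ,
    (λ k y _ Cy → centraliser-conjugationClosed T Tconj k y Cy)

  -- A minimal normal subgroup N with an element x ≠ ε decides every P:
  -- 1 ∪ {n ∈ N | P} is normal in G and contained in N, hence it is 1 (so ¬ P,
  -- as x is not in it) or all of N (so P, as x is in it).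
  minimalNormal⇒excludedMiddle : (N : Subset G) → IsMinimalNormal G N →
    ∀ x → N x → ¬ x ≡ ε → ExcludedMiddle 0ℓ
  minimalNormal⇒excludedMiddle N (((Nε , N∙ , N⁻) , _ , Nconj) , _ , minimal) x Nx x≢ε {P}
    with minimal M M-normal M⊆N
    where
    M : Subset G
    M y = y ≡ ε ⊎ (N y × P)
    M⊆N : _⊆_ G M N
    M⊆N y (inj₁ refl) = Nε
    M⊆N y (inj₂ (Ny , _)) = Ny
    M∙ : ∀ y z → M y → M z → M (y ∙ z)
    M∙ y z (inj₁ y≡ε) (inj₁ z≡ε) = inj₁ (proj₁ (proj₂ trivialSubgroup) y z y≡ε z≡ε)
    M∙ y z (inj₁ y≡ε) (inj₂ (Nz , p)) = inj₂ (N∙ y z (M⊆N y (inj₁ y≡ε)) Nz , p)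
    M∙ y z (inj₂ (Ny , p)) Mz = inj₂ (N∙ y z Ny (M⊆N z Mz) , p)
    M⁻ : ∀ y → M y → M (y ⁻¹)
    M⁻ y (inj₁ y≡ε) = inj₁ (proj₂ (proj₂ trivialSubgroup) y y≡ε)
    M⁻ y (inj₂ (Ny , p)) = inj₂ (N⁻ y Ny , p)
    Mconj : ∀ k y → M y → M (conj k y)
    Mconj k y (inj₁ y≡ε) = inj₁ (trans (cong (conj k) y≡ε) (conj-ε k))
    Mconj k y (inj₂ (Ny , p)) = inj₂ (Nconj k y tt Ny , p)
    M-normal : IsNormal G M
    M-normal = (inj₁ refl , M∙ , M⁻) , (λ _ _ → tt) , (λ k y _ → Mconj k y)
  ... | inj₁ M-trivial = no (λ p → x≢ε (M-trivial x (inj₂ (Nx , p))))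
  ... | inj₂ N⊆M with N⊆M x Nx
  ...   | inj₁ x≡ε = ⊥-elim (x≢ε x≡ε)
  ...   | inj₂ (_ , p) = yes p

  module Descent (em : ExcludedMiddle 0ℓ) where

    χ : Subset G → Carrier → Bool
    χ P y = isYes (em {P y})

    -- A normal subgroup strictly between 1 and M, given by a Boolean
    -- predicate (so that this is a proposition in Set), with a witness x of
    -- properness; when there is none, M is minimal normal.
    ProperNormalBelow : Subset G → Set
    ProperNormalBelow M = Σ (Carrier → Bool) λ b →
      IsNormal G (λ y → T (b y)) × _⊆_ G (λ y → T (b y)) M ×
      ¬ IsTrivial G (λ y → T (b y)) × Σ Carrier λ x → M x × ¬ T (b x)

    minimal-unless-properNormalBelow : (M : Subset G) → IsNormal G M → ¬ IsTrivial G M →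
      ¬ ProperNormalBelow M → IsMinimalNormal G M
    minimal-unless-properNormalBelow M M-normal M-nontrivial noProper =
      M-normal , M-nontrivial , minimality
      where
      minimality : ∀ M′ → IsNormal G M′ → _⊆_ G M′ M → IsTrivial G M′ ⊎ _⊆_ G M M′
      minimality M′ M′-normal M′⊆M with em {IsTrivial G M′}
      ... | yes M′-trivial = inj₁ M′-trivial
      ... | no M′-nontrivial = inj₂ M⊆M′
        where
        sound : ∀ y → T (χ M′ y) → M′ y
        sound y = toWitness
        complete : ∀ y → M′ y → T (χ M′ y)
        complete y = fromWitness
        M⊆M′ : _⊆_ G M M′
        M⊆M′ y My with em {M′ y}
        ... | yes M′y = M′y
        ... | no ¬M′y = ⊥-elim (noProper (χ M′
          , normal-resp M′ _ complete sound M′-normal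
          , (λ z χz → M′⊆M z (sound z χz))
          , (λ χ-trivial → M′-nontrivial (λ z M′z → χ-trivial z (complete z M′z)))
          , y , My , (λ χy → ¬M′y (sound y χy))))

    -- Descent along a shrinking list covering M: passing to a proper normal
    -- subgroup B lets us drop the witness x ∉ B from the list.
    minimalNormalBelow′ : ∀ fuel (M : Subset G) → IsNormal G M → ¬ IsTrivial G M →
      (xs : List Carrier) → length xs ≤ fuel → (∀ y → M y → y ∈ xs) →
      Σ (Subset G) λ N → IsMinimalNormal G N × _⊆_ G N M
    minimalNormalBelow′ zero M _ M-nontrivial [] _ covers =
      ⊥-elim (M-nontrivial (λ y My → ⊥-elim (∉[] (covers y My))))
    minimalNormalBelow′ (suc fuel) M M-normal M-nontrivial xs xs≤ covers
      with em {ProperNormalBelow M}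
    ... | no noProper =
      M , minimal-unless-properNormalBelow M M-normal M-nontrivial noProper , (λ y My → My)
    ... | yes (b , B-normal , B⊆M , B-nontrivial , x , Mx , ¬Bx)
      with minimalNormalBelow′ fuel (λ y → T (b y)) B-normal B-nontrivial
             (filter ≢x? xs) shorter coversB
      where
      ≢x? = λ y → ¬? (y ≟ x)
      shorter : length (filter ≢x? xs) ≤ fuel
      shorter = ≤-pred (≤-trans (filter-notAll ≢x? xs
        (Any.map (λ y≡x y≢x → y≢x (sym y≡x)) (covers x Mx))) xs≤)
      coversB : ∀ y → T (b y) → y ∈ filter ≢x? xs
      coversB y By = ∈-filter⁺ ≢x? (covers y (B⊆M y By)) (λ y≡x → ¬Bx (subst (λ z → T (b z)) y≡x By))
    ...   | N , N-minimal , N⊆B = N , N-minimal , (λ y Ny → B⊆M y (N⊆B y Ny))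

    minimalNormalBelow : (M : Subset G) → IsNormal G M → ¬ IsTrivial G M →
      Σ (Subset G) λ N → IsMinimalNormal G N × _⊆_ G N M
    minimalNormalBelow M M-normal M-nontrivial =
      minimalNormalBelow′ (length elements) M M-normal M-nontrivial elements ≤-refl (λ y _ → ∈-elements y)

  module _ (S : Subset G) (S-socle : IsSocle G S) (S-simple : IsNonabelianSimple G S) where
    private
      S-conj = socle-conjugationClosed S S-socle
      S-subgroup = proj₁ S-socle
      S∙ = proj₁ (proj₂ S-subgroup)
      S⁻ = proj₂ (proj₂ S-subgroup)

    -- Z(S) = S ∩ C_G(S) is normal in S; it is not all of S since S is
    -- nonabelian, so by simplicity it is trivial.
    socle-centre-trivial : IsTrivial G (λ y → S y × Centraliser S y)
    socle-centre-trivial with proj₂ (proj₂ (proj₂ S-simple)) Z Z-normalInS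
      where
      Z : Subset G
      Z y = S y × Centraliser S y
      C-subgroup = centraliser-subgroup S
      Z-normalInS : IsNormalIn G Z S
      Z-normalInS =
        ( (proj₁ S-subgroup , proj₁ C-subgroup)
        , (λ x y Zx Zy → S∙ x y (proj₁ Zx) (proj₁ Zy) , proj₁ (proj₂ C-subgroup) x y (proj₂ Zx) (proj₂ Zy))
        , (λ x Zx → S⁻ x (proj₁ Zx) , proj₂ (proj₂ C-subgroup) x (proj₂ Zx)))
        , (λ x Zx → proj₁ Zx)
        , (λ k h Sk Zh → S∙ _ _ (S∙ _ _ Sk (proj₁ Zh)) (S⁻ k Sk)
                        , centraliser-conjugationClosed S S-conj k h (proj₂ Zh))
    ... | inj₁ Z-trivial = Z-trivial
    ... | inj₂ S⊆Z = ⊥-elim (proj₁ (proj₂ (proj₂ S-simple)) (λ x y Sx Sy → proj₂ (S⊆Z x Sx) y Sy))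

    -- C_G(S) = 1.  Given c ≠ ε in it we show S = 1: an element x ≠ ε of a
    -- minimal normal subgroup yields excluded middle, hence a minimal normal
    -- N ≤ C_G(S); but N ≤ S, so N ≤ Z(S) = 1, a contradiction.
    centraliser-socle-trivial : ∀ c → Centraliser S c → c ≡ ε
    centraliser-socle-trivial c Cc with c ≟ ε
    ... | yes c≡ε = c≡ε
    ... | no c≢ε = ⊥-elim (proj₁ (proj₂ S-simple) S-trivial)
      where
      C-normal = centraliser-normal S S-conj
      C-nontrivial : ¬ IsTrivial G (Centraliser S)
      C-nontrivial C-trivial = c≢ε (C-trivial c Cc)
      contradiction : ExcludedMiddle 0ℓ → ⊥
      contradiction em with Descent.minimalNormalBelow em (Centraliser S) C-normal C-nontrivial
      ... | N , N-minimal , N⊆C = proj₁ (proj₂ N-minimal) (λ y Ny →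
        socle-centre-trivial y (proj₁ (proj₂ S-socle) N N-minimal y Ny , N⊆C y Ny))
      minimal-trivial : ∀ N → IsMinimalNormal G N → _⊆_ G N (_≡ ε)
      minimal-trivial N N-minimal x Nx with x ≟ ε
      ... | yes x≡ε = x≡ε
      ... | no x≢ε = ⊥-elim (contradiction (minimalNormal⇒excludedMiddle N N-minimal x Nx x≢ε))
      S-trivial : IsTrivial G S
      S-trivial = proj₂ (proj₂ S-socle) (_≡ ε) trivialSubgroup minimal-trivial

  centralises*-mono : (S T : Subset G) → _⊆_ G T S → (σ : Carrier ↔ Carrier) →
    Centralises* G S σ → Centralises* G T σ
  centralises*-mono S T T⊆S σ cent x y g Tx Ty = cent x y g (T⊆S x Tx) (T⊆S y Ty)

  -- If σ centralises T* for a conjugation-closed T ∋ ε, then the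
  -- displacement g⁻¹ σ(g) centralises T: with s = g t g⁻¹ ∈ T we have
  -- σ(g) t = σ(g t) = σ(s g) = s σ(g).
  displacement-centralises : (T : Subset G) → T ε → ConjugationClosed T →
    (σ : Carrier ↔ Carrier) → Centralises* G T σ → ∀ g → Centraliser T (g ⁻¹ ∙ Inverse.to σ g)
  displacement-centralises T Tε Tconj σ cent g t Tt = begin
    (g ⁻¹ ∙ f g) ∙ t ≡⟨ assoc (g ⁻¹) (f g) t ⟩
    g ⁻¹ ∙ (f g ∙ t) ≡⟨ cong (g ⁻¹ ∙_) σg-swap ⟩
    g ⁻¹ ∙ (s ∙ f g) ≡⟨ cong (g ⁻¹ ∙_) (assoc (g ∙ t) (g ⁻¹) (f g)) ⟩
    g ⁻¹ ∙ ((g ∙ t) ∙ (g ⁻¹ ∙ f g)) ≡⟨ cong (g ⁻¹ ∙_) (assoc g t (g ⁻¹ ∙ f g)) ⟩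
    g ⁻¹ ∙ (g ∙ (t ∙ (g ⁻¹ ∙ f g))) ≡⟨ cancelˡ (inverseˡ g) (t ∙ (g ⁻¹ ∙ f g)) ⟩
    t ∙ (g ⁻¹ ∙ f g) ∎
    where
    f = Inverse.to σ
    s = conj g t
    right : f (g ∙ t) ≡ f g ∙ t
    right = subst₂ (λ u v → f (u ∙ t) ≡ v ∙ t) (identityˡ g) (identityˡ (f g)) (cent ε t g Tε Tt)
    left : f (s ∙ g) ≡ s ∙ f g
    left = subst₂ (λ u v → f u ≡ v) (identityʳ (s ∙ g)) (identityʳ (s ∙ f g)) (cent s ε g (Tconj g t Tt) Tε)
    σg-swap : f g ∙ t ≡ s ∙ f g
    σg-swap = begin
      f g ∙ t ≡⟨ sym right ⟩
      f (g ∙ t) ≡⟨ cong f (sym (cancelʳ (inverseˡ g) (g ∙ t))) ⟩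
      f (s ∙ g) ≡⟨ left ⟩
      s ∙ f g ∎

-- Main theorem: σ(g) = g · (g⁻¹ σ(g)) and the displacement lies in the
-- centraliser of the nonabelian simple socle S′, which is trivial.  (S′ ⊆ S,
-- both being socles.)
lemma5p2 : (G : FinGroup) → IsAlmostSimple G →
    (S : FinGroup.Carrier G → Set) → IsSocle G S →
    (σ : FinGroup.Carrier G ↔ FinGroup.Carrier G) → Centralises* G S σ →
    ∀ g → Inverse.to σ g ≡ g
lemma5p2 G (S′ , S′-socle , S′-simple) S S-socle σ cent g = begin
  f g ≡⟨ sym (cancelˡ (inverseʳ g) (f g)) ⟩
  g ∙ (g ⁻¹ ∙ f g) ≡⟨ cong (g ∙_) (centraliser-socle-trivial G S′ S′-socle S′-simple _ displacement) ⟩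
  g ∙ ε ≡⟨ identityʳ g ⟩
  g ∎
  where
  open FinGroup G
  open IsGroup isGroup using (identityʳ; inverseʳ)
  open MonoidProperties (Group.monoid (group G)) using (cancelˡ)
  open ≡-Reasoning
  f = Inverse.to σ
  S′⊆S : _⊆_ G S′ S
  S′⊆S = proj₂ (proj₂ S′-socle) S (proj₁ S-socle) (proj₁ (proj₂ S-socle))
  displacement : Centraliser G S′ (g ⁻¹ ∙ f g)
  displacement = displacement-centralises G S′ (proj₁ (proj₁ S′-socle))
    (socle-conjugationClosed G S′ S′-socle) σ (centralises*-mono G S S′ S′⊆S σ cent) g
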